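{- Let $V$ be a finite set, $F$ a finite Abelian group and $A\subseteq F$ with $A=-A$. Put $f=|F|$, $v=|V|$, $\alpha=|A|/f$, $\overline{A}=F\setminus A$, $\overline{\alpha}=1-\alpha$. Then, as vectors in $\mathbb{C}^{P_V}$, $$J_{\alpha}^{ -1}\Gamma^{A}=(-1)^e\,J_{\overline{\alpha}}^{ -1}\Gamma^{\overline{A}}.$$
   Context: For an edge set $E\subseteq\binom{V}{2}$, $c(E)$ denotes the number of connected components of the graph with vertex set $V$ and edge set $E$. $P_V$ is the set of isthmus-free edge sets: $P_V=\{E\subseteq\binom{V}{2} : c(E)=c(E\setminus\{t\})\text{ for every }t\in E\}$ (it contains $\emptyset$). $\mathbb{C}^{P_V}$ is the complex vector space with coordinates $[x]_E$, $E\in P_V$. Fix an orientation of each edge $t=\{u,w\}$ as $(u,w)$; the coboundary $\delta=\delta_E:F^V\to F^E$ is $[\delta X]_t=X_u-X_w$ (since $A=-A$ the orientation is irrelevant below). $\Gamma^{A}\in\mathbb{C}^{P_V}$ has coordinates $[\Gamma^A]_E=f^{ -v}\,|\delta_E^{ -1}(A^E)|$, i.e. the probability that a uniformly random $X\in F^V$ satisfies $X_u-X_w\in A$ for all $\{u,w\}\in E$; $\Gamma^{\overline{A}}$ is defined in the same way with $\overline{A}$ in place of $A$. For a complex number $r$, $J_r$ is the linear operator on $\mathbb{C}^{P_V}$ given by $[J_r x]_E=\sum_{H\in P_V,\ H\subseteq E} r^{|E|-|H|}[x]_H$ (a unitriangular, hence invertible, operator), and $(-1)^e$ is the diagonal operator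 $[(-1)^e x]_E=(-1)^{|E|}[x]_E$. -}

module Defs where

open import Level using (0ℓ)
open import Algebra.Bundles using (AbelianGroup)
open import Data.Bool using (Bool; true; false; not; _∧_; _∨_; if_then_else_)
open import Data.Nat as ℕ using (ℕ; zero; suc; NonZero; _∸_)
open import Data.Nat.Properties using (m^n≢0)
open import Data.Fin using (Fin; toℕ)
open import Data.Fin.Properties using () renaming (_≟_ to _≟ᶠ_)
open import Data.Fin.Subset using (Subset; _⊆_; ∣_∣)
open import Data.Fin.Subset.Properties using (_⊆?_)
open import Data.List as List using (List; []; _∷_; allFin; length; filter; foldr; concatMap)
import Data.List.Base
open import Data.Vec as Vec using (Vec; []; _∷_; lookup; _[_]≔_)
open import Data.Product using (_×_; _,_; proj₁; proj₂; Σ)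
open import Data.Integer using (+_)
open import Data.Rational as ℚ using (ℚ; 0ℚ; 1ℚ; _*_; _+_; -_)
open import Relation.Binary.PropositionalEquality using (_≡_)
open import Relation.Nullary.Decidable using (⌊_⌋)

record FiniteAbelianGroup : Set₁ where
  field
    abGroup : AbelianGroup 0ℓ 0ℓ
  open AbelianGroup abGroup public
  field
    f          : ℕ
    enum       : Fin f → Carrier
    enum-inj   : ∀ i j → enum i ≈ enum j → i ≡ j
    enum-surj  : ∀ x → Σ (Fin f) (λ i → enum i ≈ x)

  _−_ : Carrier → Carrier → Carrier
  x − y = x ∙ (y ⁻¹)

nonZeroOfFin : ∀ {n} → Fin n → NonZero n
nonZeroOfFin {suc n} _ = _

count : ∀ {X : Set} → (X → Bool) → List X → ℕ
count p xs = length (filter (λ x → Data.Bool.T? (p x)) xs)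
  where import Data.Bool

sumℚ : List ℚ → ℚ
sumℚ = foldr _+_ 0ℚ

anyᵇ : ∀ {X : Set} → (X → Bool) → List X → Bool
anyᵇ p = foldr (λ x b → p x ∨ b) false

allᵇ : ∀ {X : Set} → (X → Bool) → List X → Bool
allᵇ p = foldr (λ x b → p x ∧ b) true

_==ᶠ_ : ∀ {n} → Fin n → Fin n → Bool
i ==ᶠ j = ⌊ i ≟ᶠ j ⌋

_==ℕ_ : ℕ → ℕ → Bool
m ==ℕ n = ⌊ m Data.Nat.≟ n ⌋
  where import Data.Nat

_<ᵇ_ : ∀ {n} → Fin n → Fin n → Bool
i <ᵇ j = toℕ i ℕ.<ᵇ toℕ j

_^ℚ_ : ℚ → ℕ → ℚ
r ^ℚ zero  = 1ℚ
r ^ℚ suc n = r * (r ^ℚ n)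

-- all vectors of length v with entries in Fin f  (i.e. all maps V → F)
allVecs : (v f : ℕ) → List (Vec (Fin f) v)
allVecs zero    f = [] ∷ []
allVecs (suc v) f = concatMap (λ i → List.map (i ∷_) (allVecs v f)) (allFin f)

allSubsets : (m : ℕ) → List (Subset m)
allSubsets zero    = [] ∷ []
allSubsets (suc m) = concatMap (λ b → List.map (b ∷_) (allSubsets m)) (true ∷ false ∷ [])

-- The complete graph on V = Fin v: its edges {i,j} are listed once,
-- oriented as (i , j) with i < j.  Edge sets E ⊆ binom(V,2) are
-- subsets of the index set Fin (nEdges v).

edgeList : (v : ℕ) → List (Fin v × Fin v)
edgeList v = filter (λ e → Data.Bool.T? (proj₁ e <ᵇ proj₂ e))
                    (concatMap (λ i → List.map (i ,_) (allFin v)) (allFin v))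
  where import Data.Bool

nEdges : ℕ → ℕ
nEdges v = length (edgeList v)

edge : (v : ℕ) → Fin (nEdges v) → Fin v × Fin v
edge v = List.lookup (edgeList v)

-- wrapped in a record so that v can be inferred from an edge set
record EdgeSet (v : ℕ) : Set where
  constructor mkE
  field bits : Subset (nEdges v)
open EdgeSet public

_∈E_ : ∀ {v} → Fin (nEdges v) → EdgeSet v → Bool
k ∈E E = lookup (bits E) k

size : ∀ {v} → EdgeSet v → ℕ
size E = ∣ bits E ∣

allEdgeSets : (v : ℕ) → List (EdgeSet v)
allEdgeSets v = List.map mkE (allSubsets (nEdges v))

adj : ∀ {v} → EdgeSet v → Fin v → Fin v → Bool
adj {v} E a b = anyᵇ (λ k → k ∈E E ∧
                  ((proj₁ (edge v k) ==ᶠ a ∧ proj₂ (edge v k) ==ᶠ b) ∨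
                   (proj₁ (edge v k) ==ᶠ b ∧ proj₂ (edge v k) ==ᶠ a)))
                (allFin (nEdges v))

reachK : ∀ {v} → EdgeSet v → ℕ → Fin v → Fin v → Bool
reachK E zero    a b = a ==ᶠ b
reachK {v} E (suc k) a b =
  reachK E k a b ∨ anyᵇ (λ l → reachK E k a l ∧ adj E l b) (allFin v)

-- a and b lie in the same connected component (walks of length ≤ v suffice)
connected : ∀ {v} → EdgeSet v → Fin v → Fin v → Bool
connected {v} E = reachK E v

-- c(E): number of connected components of (V, E), counted as the number of
-- vertices that are the least vertex of their component
c : ∀ {v} → EdgeSet v → ℕ
c {v} E = count (λ i → not (anyᵇ (λ j → (j <ᵇ i) ∧ connected E j i) (allFin v)))
                (allFin v)

remove : ∀ {v} → EdgeSet v → Fin (nEdges v) → EdgeSet v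
remove E k = mkE (bits E [ k ]≔ false)

inP : ∀ {v} → EdgeSet v → Bool
inP {v} E = allᵇ (λ k → not (k ∈E E) ∨ (c E ==ℕ c (remove E k)))
                 (allFin (nEdges v))

InP : ∀ {v} → EdgeSet v → Set
InP E = inP E ≡ true

-- vectors in ℚ^{P_V} (coordinates outside P_V are irrelevant)
Vector : ℕ → Set
Vector v = EdgeSet v → ℚ

J : ∀ {v} → ℚ → Vector v → Vector v
J {v} r x E = sumℚ (List.map (λ H → (r ^ℚ (size E ∸ size H)) * x H)
                   (filter (λ H → Data.Bool.T? (inP H ∧ ⌊ bits H ⊆? bits E ⌋))
                           (allEdgeSets v)))
  where import Data.Bool

signE : ∀ {v} → Vector v → Vector v
signE x E = ((- 1ℚ) ^ℚ size E) * x E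

module _ (F : FiniteAbelianGroup) where
  open FiniteAbelianGroup F

  goodFor : ∀ {v} → (Carrier → Bool) → EdgeSet v → Vec (Fin f) v → Bool
  goodFor {v} A E X =
    allᵇ (λ k → not (k ∈E E) ∨
                A (enum (lookup X (proj₁ (edge v k))) − enum (lookup X (proj₂ (edge v k)))))
         (allFin (nEdges v))

  -- [Γ^A]_E = f^{-v} |δ_E^{-1}(A^E)|   (requires f ≠ 0, true since ε ∈ F)
  Γ : ∀ {v} → (Carrier → Bool) → Vector v
  Γ {v} A E = (+ count (goodFor A E) (allVecs v f)) ℚ./ (f ℕ.^ v)
      where instance _ = m^n≢0 f v {{nonZeroOfFin (proj₁ (enum-surj ε))}}

  card : (Carrier → Bool) → ℕ
  card A = count (λ i → A (enum i)) (allFin f)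

  density : (Carrier → Bool) → ℚ
  density A = (+ card A) ℚ./ f
      where instance _ = nonZeroOfFin (proj₁ (enum-surj ε))

  compl : (Carrier → Bool) → (Carrier → Bool)
  compl A x = not (A x)

-- For an edge t = (u, w) put χ_t(X) = 𝟙_A(X_u − X_w) − α. Expanding ∏_{t ∈ E} (α + χ_t(X)) and
-- averaging over X ∈ F^V gives Γ^A = J_α m, where m_H = f^{-v} ∑_X ∏_{t ∈ H} χ_t(X), as soon as m
-- vanishes outside P_V. It does: if t is an isthmus of H, translating X by c ∈ F on one side of the
-- cut it determines changes only the factor χ_t, and averaging over c kills it because χ_t has mean zero.
-- Since J_α is unitriangular, J_α⁻¹ Γ^A = m. For Ā and ᾱ = 1 − α every χ_t changes sign, so the
-- corresponding m is (−1)^{|E|} m_E.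

module Submission where

open import Function using (_∘_; id; Equivalence)
open Equivalence using (to; from)
open import Data.Bool as Bool using (Bool; true; false; not; _∧_; _∨_; T; if_then_else_)
open import Data.Bool.Properties using (T-∧; T-∨; T-≡; ∨-conicalˡ; ∨-conicalʳ; not-involutive)
open import Data.Nat as ℕ using (ℕ; zero; suc; NonZero; _∸_; _≤_; _<_; z≤n; s≤s)
import Data.Nat.Properties as ℕ
import Data.Integer as ℤ
import Data.Integer.Properties as ℤ
open import Data.Integer.Solver using () renaming (module +-*-Solver to ℤ-Solver)
open import Data.Rational as ℚ using (ℚ; 0ℚ; 1ℚ; _+_; _*_; -_; _-_; _/_)
open import Data.Rational.Properties
  using ( +-identityˡ; +-identityʳ; +-inverseʳ; +-assoc; *-identityˡ; *-zeroˡ; *-zeroʳ; *-assoc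
        ; 0/n≡0; fromℚᵘ-cong; fromℚᵘ-toℚᵘ; toℚᵘ-fromℚᵘ; toℚᵘ-homo-+
        ; neg-distrib-+; +-0-commutativeMonoid; +-0-group)
open import Data.Rational.Solver using (module +-*-Solver)
import Data.Rational.Unnormalised as ℚᵘ
import Data.Rational.Unnormalised.Properties as ℚᵘ
open import Algebra.Properties.CommutativeMonoid.Sum +-0-commutativeMonoid using (sum; sum-permute)
open import Algebra.Properties.Group +-0-group using (x∙y⁻¹≈ε⇒x≈y)
open import Algebra.Bundles using (AbelianGroup)
import Algebra.Properties.AbelianGroup as AbelianGroupProperties
import Algebra.Properties.CommutativeSemigroup as CommutativeSemigroupProperties
import Relation.Binary.Reasoning.Setoid as SetoidReasoning
open import Data.List as List using (List; []; _∷_; _++_; concatMap; filter; allFin)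
import Data.List.Properties as List
open import Data.List.Relation.Unary.Any as Any using ()
open import Data.List.Membership.Propositional using () renaming (_∈_ to _∈ₗ_)
open import Data.List.Membership.Propositional.Properties using (∈-allFin)
open import Data.Product using (_×_; _,_; proj₁; proj₂; ∃-syntax)
open import Data.Sum using (_⊎_; inj₁; inj₂)
open import Data.Empty using (⊥-elim)
open import Data.Fin as Fin using (Fin; zero; suc)
import Data.Fin.Properties as Fin
open import Data.Fin.Permutation using (permutation)
open import Data.Fin.Subset using (Subset; inside; outside; _⊆_; _∈_; ∣_∣)
open import Data.Fin.Subset.Properties using (_⊆?_; ⊆-refl; drop-∷-⊆; p⊆q⇒∣p∣≤∣q∣)
open import Data.Vec as Vec using (Vec; []; _∷_; here; there; _[_]≔_)
import Data.Vec.Properties as Vec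
open import Relation.Binary.PropositionalEquality hiding (J; setoid)
open import Relation.Nullary using (yes; no; ¬_; contradiction)
open import Relation.Nullary.Decidable using (⌊_⌋; does; dec-true; isYes≗does; toWitness; fromWitness)
open import Defs


private
  variable
    X Y : Set

∑ : List X → (X → ℚ) → ℚ
∑ xs h = sumℚ (List.map h xs)

infix 2 ∑

syntax ∑ xs (λ x → e) = ∑[ x ← xs ] e

∑-++ : ∀ xs ys (h : X → ℚ) → ∑ (xs ++ ys) h ≡ ∑ xs h + ∑ ys h
∑-++ []       ys h = sym (+-identityˡ _)
∑-++ (x ∷ xs) ys h = trans (cong (h x +_) (∑-++ xs ys h)) (sym (+-assoc (h x) _ _))

∑-concatMap : ∀ (g : X → List Y) xs (h : Y → ℚ) →
              ∑ (concatMap g xs) h ≡ (∑[ x ← xs ] ∑ (g x) h)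
∑-concatMap g []       h = refl
∑-concatMap g (x ∷ xs) h = trans (∑-++ (g x) _ h) (cong (∑ (g x) h +_) (∑-concatMap g xs h))

∑-map : ∀ (g : X → Y) xs (h : Y → ℚ) → ∑ (List.map g xs) h ≡ (∑[ x ← xs ] h (g x))
∑-map g []       h = refl
∑-map g (x ∷ xs) h = cong (h (g x) +_) (∑-map g xs h)

∑-cong : ∀ xs {h h′ : X → ℚ} → (∀ x → h x ≡ h′ x) → ∑ xs h ≡ ∑ xs h′
∑-cong []       eq = refl
∑-cong (x ∷ xs) eq = cong₂ _+_ (eq x) (∑-cong xs eq)

∑-zero : ∀ xs {h : X → ℚ} → (∀ x → h x ≡ 0ℚ) → ∑ xs h ≡ 0ℚ
∑-zero []       eq = refl
∑-zero (x ∷ xs) eq = trans (cong₂ _+_ (eq x) (∑-zero xs eq)) (+-identityˡ 0ℚ)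

∑-distrib-+ : ∀ xs (h h′ : X → ℚ) → (∑[ x ← xs ] (h x + h′ x)) ≡ ∑ xs h + ∑ xs h′
∑-distrib-+ []       h h′ = refl
∑-distrib-+ (x ∷ xs) h h′ = trans (cong (h x + h′ x +_) (∑-distrib-+ xs h h′))
  (solve 4 (λ a b c d → (a :+ b) :+ (c :+ d) := (a :+ c) :+ (b :+ d)) refl (h x) (h′ x) _ _)
  where open +-*-Solver

∑-distrib-- : ∀ xs (h h′ : X → ℚ) → (∑[ x ← xs ] (h x - h′ x)) ≡ ∑ xs h - ∑ xs h′
∑-distrib-- []       h h′ = refl
∑-distrib-- (x ∷ xs) h h′ = trans (cong (h x - h′ x +_) (∑-distrib-- xs h h′))
  (solve 4 (λ a b c d → (a :- b) :+ (c :- d) := (a :+ c) :- (b :+ d)) refl (h x) (h′ x) _ _)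
  where open +-*-Solver

∑-neg : ∀ xs (h : X → ℚ) → (∑[ x ← xs ] (- h x)) ≡ - ∑ xs h
∑-neg []       h = refl
∑-neg (x ∷ xs) h = trans (cong (- h x +_) (∑-neg xs h)) (sym (neg-distrib-+ (h x) _))

∑-*ˡ : ∀ xs c (h : X → ℚ) → (∑[ x ← xs ] (c * h x)) ≡ c * ∑ xs h
∑-*ˡ []       c h = sym (*-zeroʳ c)
∑-*ˡ (x ∷ xs) c h = trans (cong (c * h x +_) (∑-*ˡ xs c h))
  (solve 3 (λ c a s → c :* a :+ c :* s := c :* (a :+ s)) refl c (h x) _)
  where open +-*-Solver

∑-*ʳ : ∀ xs c (h : X → ℚ) → (∑[ x ← xs ] (h x * c)) ≡ ∑ xs h * c
∑-*ʳ []       c h = sym (*-zeroˡ c)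
∑-*ʳ (x ∷ xs) c h = trans (cong (h x * c +_) (∑-*ʳ xs c h))
  (solve 3 (λ c a s → a :* c :+ s :* c := (a :+ s) :* c) refl c (h x) _)
  where open +-*-Solver

∑-comm : ∀ xs ys (h : X → Y → ℚ) → (∑[ x ← xs ] ∑[ y ← ys ] h x y) ≡ (∑[ y ← ys ] ∑[ x ← xs ] h x y)
∑-comm []       ys h = sym (∑-zero ys (λ _ → refl))
∑-comm (x ∷ xs) ys h =
  trans (cong (∑ ys (h x) +_) (∑-comm xs ys h)) (sym (∑-distrib-+ ys (h x) _))

𝟙 : Bool → ℚ
𝟙 true  = 1ℚ
𝟙 false = 0ℚ

𝟙-∧ : ∀ a b → 𝟙 (a ∧ b) ≡ 𝟙 a * 𝟙 b
𝟙-∧ true  b = sym (*-identityˡ (𝟙 b))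
𝟙-∧ false b = sym (*-zeroˡ (𝟙 b))

𝟙-not : ∀ b β → 𝟙 (not b) - (1ℚ - β) ≡ - (𝟙 b - β)
𝟙-not true  β = solve 1 (λ β → con 0ℚ :- (con 1ℚ :- β) := :- (con 1ℚ :- β)) refl β
  where open +-*-Solver
𝟙-not false β = solve 1 (λ β → con 1ℚ :- (con 1ℚ :- β) := :- (con 0ℚ :- β)) refl β
  where open +-*-Solver

∑-filter : ∀ (p : X → Bool) (h : X → ℚ) xs →
           sumℚ (List.map h (filter (λ x → Bool.T? (p x)) xs)) ≡ (∑[ x ← xs ] (𝟙 (p x) * h x))
∑-filter p h []       = refl
∑-filter p h (x ∷ xs) with p x
... | true  = cong₂ _+_ (sym (*-identityˡ (h x))) (∑-filter p h xs)
... | false = trans (∑-filter p h xs)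
                (sym (trans (cong (_+ _) (*-zeroˡ (h x))) (+-identityˡ _)))

fromℚᵘ-homo-+ : ∀ p q → ℚ.fromℚᵘ (p ℚᵘ.+ q) ≡ ℚ.fromℚᵘ p + ℚ.fromℚᵘ q
fromℚᵘ-homo-+ p q = trans
  (fromℚᵘ-cong (ℚᵘ.≃-sym (ℚᵘ.≃-trans (toℚᵘ-homo-+ (ℚ.fromℚᵘ p) (ℚ.fromℚᵘ q))
                                     (ℚᵘ.+-cong (toℚᵘ-fromℚᵘ p) (toℚᵘ-fromℚᵘ q)))))
  (fromℚᵘ-toℚᵘ _)

/-suc : ∀ n d .{{_ : NonZero d}} → ℤ.+ suc n / d ≡ ℤ.+ 1 / d + ℤ.+ n / d
/-suc n (suc d) = trans
  (fromℚᵘ-cong {ℚᵘ.mkℚᵘ (ℤ.+ suc n) d} {ℚᵘ.mkℚᵘ (ℤ.+ 1) d ℚᵘ.+ ℚᵘ.mkℚᵘ (ℤ.+ n) d}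
                (ℚᵘ.*≡* cross))
  (fromℚᵘ-homo-+ (ℚᵘ.mkℚᵘ (ℤ.+ 1) d) (ℚᵘ.mkℚᵘ (ℤ.+ n) d))
  where
  open ℤ-Solver
  cross : ℤ.+ suc n ℤ.* ℤ.+ (suc d ℕ.* suc d) ≡ (ℤ.+ 1 ℤ.* ℤ.+ suc d ℤ.+ ℤ.+ n ℤ.* ℤ.+ suc d) ℤ.* ℤ.+ suc d
  cross rewrite ℤ.pos-* (suc d) (suc d) =
    solve 2 (λ x y → (con (ℤ.+ 1) :+ x) :* (y :* y) := (con (ℤ.+ 1) :* y :+ x :* y) :* y) refl (ℤ.+ n) (ℤ.+ suc d)

n/n≡1 : ∀ n .{{_ : NonZero n}} → ℤ.+ n / n ≡ 1ℚ
n/n≡1 (suc d) = fromℚᵘ-cong {ℚᵘ.mkℚᵘ (ℤ.+ suc d) d} {ℚᵘ.1ℚᵘ} (ℚᵘ.*≡* (ℤ.*-comm (ℤ.+ suc d) (ℤ.+ 1)))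

count-/ : ∀ (p : X → Bool) xs d .{{_ : NonZero d}} →
          ℤ.+ count p xs / d ≡ (∑[ x ← xs ] (𝟙 (p x) * (ℤ.+ 1 / d)))
count-/ p []       d = 0/n≡0 d
count-/ p (x ∷ xs) d with p x
... | true  = trans (/-suc (count p xs) d) (cong₂ _+_ (sym (*-identityˡ (ℤ.+ 1 / d))) (count-/ p xs d))
... | false = trans (count-/ p xs d) (sym (trans (cong (_+ rest) (*-zeroˡ (ℤ.+ 1 / d))) (+-identityˡ rest)))
  where rest = ∑[ x ← xs ] (𝟙 (p x) * (ℤ.+ 1 / d))

count-true : ∀ (xs : List X) → count (λ _ → true) xs ≡ List.length xs
count-true []       = refl
count-true (x ∷ xs) = cong suc (count-true xs)

∑-allFin-1/n : ∀ n .{{_ : NonZero n}} → (∑[ a ← allFin n ] (ℤ.+ 1 / n)) ≡ 1ℚ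
∑-allFin-1/n n = begin
  (∑[ a ← allFin n ] (ℤ.+ 1 / n))          ≡⟨ ∑-cong (allFin n) (λ _ → *-identityˡ (ℤ.+ 1 / n)) ⟨
  (∑[ a ← allFin n ] (1ℚ * (ℤ.+ 1 / n)))   ≡⟨ count-/ (λ _ → true) (allFin n) n ⟨
  ℤ.+ count (λ _ → true) (allFin n) / n    ≡⟨ cong (λ m → ℤ.+ m / n) count≡n ⟩
  ℤ.+ n / n                               ≡⟨ n/n≡1 n ⟩
  1ℚ                                      ∎
  where
  open ≡-Reasoning
  count≡n : count (λ _ → true) (allFin n) ≡ n
  count≡n = trans (count-true (allFin n)) (List.length-tabulate {n = n} id)

allFin-suc : ∀ n → allFin (suc n) ≡ zero ∷ List.map suc (allFin n)
allFin-suc n = cong (zero ∷_) (sym (List.map-tabulate id suc))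

∑-allFin : ∀ n (h : Fin n → ℚ) → ∑ (allFin n) h ≡ sum h
∑-allFin zero    h = refl
∑-allFin (suc n) h = begin
  ∑ (allFin (suc n)) h                 ≡⟨ cong (λ xs → ∑ xs h) (allFin-suc n) ⟩
  h zero + ∑ (List.map suc (allFin n)) h ≡⟨ cong (h zero +_) (∑-map suc (allFin n) h) ⟩
  h zero + ∑ (allFin n) (h ∘ suc)        ≡⟨ cong (h zero +_) (∑-allFin n (h ∘ suc)) ⟩
  h zero + sum (h ∘ suc)                 ∎
  where open ≡-Reasoning

∑-allFin-permute : ∀ {n} (σ τ : Fin n → Fin n) → (∀ a → σ (τ a) ≡ a) → (∀ a → τ (σ a) ≡ a) →
                   ∀ h → (∑[ a ← allFin n ] h (σ a)) ≡ ∑ (allFin n) h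
∑-allFin-permute {n} σ τ στ τσ h = begin
  (∑[ a ← allFin n ] h (σ a)) ≡⟨ ∑-allFin n (h ∘ σ) ⟩
  sum (h ∘ σ)               ≡⟨ sum-permute h (permutation σ τ στ τσ) ⟨
  sum h                     ≡⟨ ∑-allFin n h ⟨
  ∑ (allFin n) h            ∎
  where open ≡-Reasoning

∑-allVecs-suc : ∀ v f (h : Vec (Fin f) (suc v) → ℚ) →
                ∑ (allVecs (suc v) f) h ≡ (∑[ a ← allFin f ] ∑[ X ← allVecs v f ] h (a ∷ X))
∑-allVecs-suc v f h = trans (∑-concatMap (λ a → List.map (a ∷_) (allVecs v f)) (allFin f) h)
                            (∑-cong (allFin f) (λ a → ∑-map (a ∷_) (allVecs v f) h))

∑-allVecs-permute : ∀ {v f} (σ τ : Fin v → Fin f → Fin f) →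
                    (∀ i a → σ i (τ i a) ≡ a) → (∀ i a → τ i (σ i a) ≡ a) → ∀ h →
                    (∑[ X ← allVecs v f ] h (Vec.tabulate (λ i → σ i (Vec.lookup X i))))
                      ≡ ∑ (allVecs v f) h
∑-allVecs-permute {zero}      σ τ στ τσ h = refl
∑-allVecs-permute {suc v} {f} σ τ στ τσ h = begin
  (∑[ X ← allVecs (suc v) f ] h (Vec.tabulate (λ i → σ i (Vec.lookup X i))))
    ≡⟨ ∑-allVecs-suc v f _ ⟩
  (∑[ a ← allFin f ] ∑[ X ← allVecs v f ] h (σ zero a ∷ Vec.tabulate (λ i → σ (suc i) (Vec.lookup X i))))
    ≡⟨ ∑-cong (allFin f) (λ a → ∑-allVecs-permute (σ ∘ suc) (τ ∘ suc) (στ ∘ suc) (τσ ∘ suc)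
                                                  (h ∘ (σ zero a ∷_))) ⟩
  (∑[ a ← allFin f ] ∑[ X ← allVecs v f ] h (σ zero a ∷ X))
    ≡⟨ ∑-allFin-permute (σ zero) (τ zero) (στ zero) (τσ zero) (λ a → ∑[ X ← allVecs v f ] h (a ∷ X)) ⟩
  (∑[ a ← allFin f ] ∑[ X ← allVecs v f ] h (a ∷ X))
    ≡⟨ ∑-allVecs-suc v f h ⟨
  ∑ (allVecs (suc v) f) h ∎
  where open ≡-Reasoning

∑-allSubsets-suc : ∀ m (h : Subset (suc m) → ℚ) →
  ∑ (allSubsets (suc m)) h ≡ (∑[ H ← allSubsets m ] h (inside ∷ H)) + (∑[ H ← allSubsets m ] h (outside ∷ H))
∑-allSubsets-suc m h = begin
  ∑ (allSubsets (suc m)) h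
    ≡⟨ ∑-concatMap (λ b → List.map (b ∷_) (allSubsets m)) (true ∷ false ∷ []) h ⟩
  ∑ (List.map (inside ∷_) (allSubsets m)) h + (∑ (List.map (outside ∷_) (allSubsets m)) h + 0ℚ)
    ≡⟨ cong₂ _+_ (∑-map (inside ∷_) (allSubsets m) h) (trans (+-identityʳ _) (∑-map (outside ∷_) (allSubsets m) h)) ⟩
  (∑[ H ← allSubsets m ] h (inside ∷ H)) + (∑[ H ← allSubsets m ] h (outside ∷ H)) ∎
  where open ≡-Reasoning

∑-allSubsets-single : ∀ {m} (E : Subset m) (h : Subset m → ℚ) → (∀ H → H ≢ E → h H ≡ 0ℚ) →
                      ∑ (allSubsets m) h ≡ h E
∑-allSubsets-single []                h _      = +-identityʳ (h [])
∑-allSubsets-single {suc m} (inside ∷ E)  h vanish = begin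
  ∑ (allSubsets (suc m)) h
    ≡⟨ ∑-allSubsets-suc m h ⟩
  (∑[ H ← allSubsets m ] h (inside ∷ H)) + (∑[ H ← allSubsets m ] h (outside ∷ H))
    ≡⟨ cong₂ _+_ (∑-allSubsets-single E _ (λ H H≢E → vanish _ (H≢E ∘ Vec.∷-injectiveʳ)))
                 (∑-zero (allSubsets m) (λ H → vanish _ λ ())) ⟩
  h (inside ∷ E) + 0ℚ
    ≡⟨ +-identityʳ _ ⟩
  h (inside ∷ E) ∎
  where open ≡-Reasoning
∑-allSubsets-single {suc m} (outside ∷ E) h vanish = begin
  ∑ (allSubsets (suc m)) h
    ≡⟨ ∑-allSubsets-suc m h ⟩
  (∑[ H ← allSubsets m ] h (inside ∷ H)) + (∑[ H ← allSubsets m ] h (outside ∷ H))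
    ≡⟨ cong₂ _+_ (∑-zero (allSubsets m) (λ H → vanish _ λ ()))
                 (∑-allSubsets-single E _ (λ H H≢E → vanish _ (H≢E ∘ Vec.∷-injectiveʳ))) ⟩
  0ℚ + h (outside ∷ E)
    ≡⟨ +-identityˡ _ ⟩
  h (outside ∷ E) ∎
  where open ≡-Reasoning

⊆∧≢⇒∣p∣<∣q∣ : ∀ {m} {p q : Subset m} → p ⊆ q → p ≢ q → ∣ p ∣ < ∣ q ∣
⊆∧≢⇒∣p∣<∣q∣ {p = []}          {[]}          _   p≢q = contradiction refl p≢q
⊆∧≢⇒∣p∣<∣q∣ {p = outside ∷ p} {outside ∷ q} p⊆q p≢q =
  ⊆∧≢⇒∣p∣<∣q∣ (drop-∷-⊆ p⊆q) (p≢q ∘ cong (outside ∷_))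
⊆∧≢⇒∣p∣<∣q∣ {p = outside ∷ p} {inside ∷ q}  p⊆q _   = s≤s (p⊆q⇒∣p∣≤∣q∣ (drop-∷-⊆ p⊆q))
⊆∧≢⇒∣p∣<∣q∣ {p = inside ∷ p}  {outside ∷ q} p⊆q _   = contradiction (p⊆q here) λ ()
⊆∧≢⇒∣p∣<∣q∣ {p = inside ∷ p}  {inside ∷ q}  p⊆q p≢q =
  s≤s (⊆∧≢⇒∣p∣<∣q∣ (drop-∷-⊆ p⊆q) (p≢q ∘ cong (inside ∷_)))

∏ : ∀ {m} → Subset m → (Fin m → ℚ) → ℚ
∏ []            g = 1ℚ
∏ (outside ∷ H) g = ∏ H (g ∘ suc)
∏ (inside ∷ H)  g = g zero * ∏ H (g ∘ suc)

∏-cong : ∀ {m} (H : Subset m) {g g′ : Fin m → ℚ} → (∀ {k} → k ∈ H → g k ≡ g′ k) → ∏ H g ≡ ∏ H g′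
∏-cong []            eq = refl
∏-cong (outside ∷ H) eq = ∏-cong H (eq ∘ there)
∏-cong (inside ∷ H)  eq = cong₂ _*_ (eq here) (∏-cong H (eq ∘ there))

∏-neg : ∀ {m} (H : Subset m) g → ∏ H (λ k → - g k) ≡ (- 1ℚ) ^ℚ ∣ H ∣ * ∏ H g
∏-neg []            g = sym (*-identityˡ 1ℚ)
∏-neg (outside ∷ H) g = ∏-neg H (g ∘ suc)
∏-neg (inside ∷ H)  g = trans (cong (- g zero *_) (∏-neg H (g ∘ suc)))
  (solve 3 (λ x s p → (:- x) :* (s :* p) := ((:- con 1ℚ) :* s) :* (x :* p)) refl
           (g zero) ((- 1ℚ) ^ℚ ∣ H ∣) (∏ H (g ∘ suc)))
  where open +-*-Solver

sign-square : ∀ n → (- 1ℚ) ^ℚ n * (- 1ℚ) ^ℚ n ≡ 1ℚ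
sign-square zero    = refl
sign-square (suc n) = trans
  (solve 1 (λ s → ((:- con 1ℚ) :* s) :* ((:- con 1ℚ) :* s) := s :* s) refl ((- 1ℚ) ^ℚ n))
  (sign-square n)
  where open +-*-Solver

∏-remove : ∀ {m} {H : Subset m} {k} → k ∈ H → ∀ g → ∏ H g ≡ g k * ∏ (H [ k ]≔ outside) g
∏-remove here g = refl
∏-remove {H = outside ∷ H} (there k∈H) g = ∏-remove k∈H (g ∘ suc)
∏-remove {H = inside ∷ H} {suc k} (there k∈H) g =
  trans (cong (g zero *_) (∏-remove k∈H (g ∘ suc)))
        (solve 3 (λ a b c → a :* (b :* c) := b :* (a :* c)) refl (g zero) (g (suc k)) _)
  where open +-*-Solver

binomialTerm : ∀ {m} → ℚ → Subset m → (Fin m → ℚ) → Subset m → ℚ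
binomialTerm β E g H = 𝟙 (does (H ⊆? E)) * (β ^ℚ (∣ E ∣ ∸ ∣ H ∣) * ∏ H g)

binomialTerm-inside : ∀ {m} β (E : Subset m) g H →
  g zero * binomialTerm β E (g ∘ suc) H ≡ binomialTerm β (inside ∷ E) g (inside ∷ H)
binomialTerm-inside β E g H = solve 4 (λ x t p q → x :* (t :* (p :* q)) := t :* (p :* (x :* q))) refl
                                (g zero) (𝟙 (does (H ⊆? E))) (β ^ℚ (∣ E ∣ ∸ ∣ H ∣)) (∏ H (g ∘ suc))
  where open +-*-Solver

binomialTerm-outside : ∀ {m} β (E : Subset m) g H →
  β * binomialTerm β E (g ∘ suc) H ≡ binomialTerm β (inside ∷ E) g (outside ∷ H)
binomialTerm-outside β E g H with H ⊆? E
... | yes H⊆E rewrite ℕ.+-∸-assoc 1 (p⊆q⇒∣p∣≤∣q∣ H⊆E) =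
  solve 3 (λ b p q → b :* (con 1ℚ :* (p :* q)) := con 1ℚ :* ((b :* p) :* q)) refl
          β (β ^ℚ (∣ E ∣ ∸ ∣ H ∣)) (∏ H (g ∘ suc))
  where open +-*-Solver
... | no _ = trans (cong (β *_) (*-zeroˡ (β ^ℚ (∣ E ∣ ∸ ∣ H ∣) * ∏ H (g ∘ suc))))
                   (trans (*-zeroʳ β) (sym (*-zeroˡ (β ^ℚ (suc ∣ E ∣ ∸ ∣ H ∣) * ∏ H (g ∘ suc)))))

∏-+-expand : ∀ {m} (E : Subset m) β g → ∏ E (λ k → β + g k) ≡ ∑ (allSubsets m) (binomialTerm β E g)
∏-+-expand []            β g = refl
∏-+-expand {suc m} (outside ∷ E) β g = begin
  ∏ E (λ k → β + g (suc k))                                   ≡⟨ ∏-+-expand E β (g ∘ suc) ⟩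
  S                                                           ≡⟨ +-identityˡ S ⟨
  0ℚ + S                                                      ≡⟨ cong (_+ S) (∑-zero (allSubsets m) excluded) ⟨
  (∑[ H ← allSubsets m ] binomialTerm β (outside ∷ E) g (inside ∷ H)) + S
                                                              ≡⟨ ∑-allSubsets-suc m (binomialTerm β (outside ∷ E) g) ⟨
  ∑ (allSubsets (suc m)) (binomialTerm β (outside ∷ E) g)     ∎
  where
  open ≡-Reasoning
  S = ∑ (allSubsets m) (binomialTerm β E (g ∘ suc))
  excluded : ∀ H → binomialTerm β (outside ∷ E) g (inside ∷ H) ≡ 0ℚ
  excluded H = *-zeroˡ (β ^ℚ (∣ E ∣ ∸ suc ∣ H ∣) * ∏ (inside ∷ H) g)
∏-+-expand {suc m} (inside ∷ E)  β g = begin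
  (β + g zero) * ∏ E (λ k → β + g (suc k))
    ≡⟨ cong ((β + g zero) *_) (∏-+-expand E β (g ∘ suc)) ⟩
  (β + g zero) * S
    ≡⟨ solve 3 (λ b x s → (b :+ x) :* s := x :* s :+ b :* s) refl β (g zero) S ⟩
  g zero * S + β * S
    ≡⟨ cong₂ _+_ (∑-*ˡ (allSubsets m) (g zero) _) (∑-*ˡ (allSubsets m) β _) ⟨
  (∑[ H ← allSubsets m ] (g zero * binomialTerm β E (g ∘ suc) H))
    + (∑[ H ← allSubsets m ] (β * binomialTerm β E (g ∘ suc) H))
    ≡⟨ cong₂ _+_ (∑-cong (allSubsets m) (binomialTerm-inside β E g))
                 (∑-cong (allSubsets m) (binomialTerm-outside β E g)) ⟩
  (∑[ H ← allSubsets m ] binomialTerm β (inside ∷ E) g (inside ∷ H))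
    + (∑[ H ← allSubsets m ] binomialTerm β (inside ∷ E) g (outside ∷ H))
    ≡⟨ ∑-allSubsets-suc m (binomialTerm β (inside ∷ E) g) ⟨
  ∑ (allSubsets (suc m)) (binomialTerm β (inside ∷ E) g) ∎
  where
  open ≡-Reasoning
  open +-*-Solver
  S = ∑ (allSubsets m) (binomialTerm β E (g ∘ suc))

-- The operator J_r

J-coeff : ∀ {v} → ℚ → EdgeSet v → Subset (nEdges v) → ℚ
J-coeff {v} r E H = 𝟙 (inP (mkE {v} H) ∧ ⌊ H ⊆? bits E ⌋) * r ^ℚ (size E ∸ ∣ H ∣)

J-∑ : ∀ {v} r (x : Vector v) E → J r x E ≡ (∑[ H ← allSubsets (nEdges v) ] (J-coeff r E H * x (mkE H)))
J-∑ {v} r x E = begin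
  J r x E
    ≡⟨ ∑-filter (λ H → inP H ∧ ⌊ bits H ⊆? bits E ⌋) (λ H → r ^ℚ (size E ∸ size H) * x H) (allEdgeSets v) ⟩
  (∑[ H ← allEdgeSets v ] (𝟙 (inP H ∧ ⌊ bits H ⊆? bits E ⌋) * (r ^ℚ (size E ∸ size H) * x H)))
    ≡⟨ ∑-map (mkE {v}) (allSubsets (nEdges v)) _ ⟩
  (∑[ H ← allSubsets (nEdges v) ] (𝟙 (inP (mkE {v} H) ∧ ⌊ H ⊆? bits E ⌋) * (r ^ℚ (size E ∸ ∣ H ∣) * x (mkE H))))
    ≡⟨ ∑-cong (allSubsets (nEdges v)) (λ H → sym (*-assoc (𝟙 (inP (mkE {v} H) ∧ ⌊ H ⊆? bits E ⌋))
                                                          (r ^ℚ (size E ∸ ∣ H ∣)) (x (mkE H)))) ⟩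
  (∑[ H ← allSubsets (nEdges v) ] (J-coeff r E H * x (mkE H))) ∎
  where open ≡-Reasoning

J-diagonal : ∀ {v} r (E : EdgeSet v) → InP E → J-coeff r E (bits E) ≡ 1ℚ
J-diagonal r E E∈P
  rewrite E∈P | isYes≗does (bits E ⊆? bits E) | dec-true (bits E ⊆? bits E) ⊆-refl | ℕ.n∸n≡0 (size E) = refl

J-injective : ∀ {v} r (y y′ : Vector v) → (∀ E → InP E → J r y E ≡ J r y′ E) →
              ∀ E → InP E → y E ≡ y′ E
J-injective {v} r y y′ J-eq E = below (suc (size E)) E ℕ.≤-refl
  where
  open ≡-Reasoning
  d : EdgeSet v → ℚ
  d E = y E - y′ E
  J-d : ∀ E → J r y E - J r y′ E ≡ (∑[ H ← allSubsets (nEdges v) ] (J-coeff r E H * d (mkE H)))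
  J-d E = begin
    J r y E - J r y′ E
      ≡⟨ cong₂ _-_ (J-∑ r y E) (J-∑ r y′ E) ⟩
    (∑[ H ← allSubsets (nEdges v) ] (J-coeff r E H * y (mkE H))) - (∑[ H ← allSubsets (nEdges v) ] (J-coeff r E H * y′ (mkE H)))
      ≡⟨ ∑-distrib-- (allSubsets (nEdges v)) _ _ ⟨
    (∑[ H ← allSubsets (nEdges v) ] (J-coeff r E H * y (mkE H) - J-coeff r E H * y′ (mkE H)))
      ≡⟨ ∑-cong (allSubsets (nEdges v)) (λ H → solve 3 (λ c a b → c :* a :- c :* b := c :* (a :- b)) refl
                                             (J-coeff r E H) (y (mkE H)) (y′ (mkE H))) ⟩
    (∑[ H ← allSubsets (nEdges v) ] (J-coeff r E H * d (mkE H))) ∎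
    where open +-*-Solver
  below : ∀ n E → size E < n → InP E → y E ≡ y′ E
  below (suc n) E |E|≤n E∈P = x∙y⁻¹≈ε⇒x≈y (y E) (y′ E) (begin
    d E                                                            ≡⟨ *-identityˡ (d E) ⟨
    1ℚ * d E                                                       ≡⟨ cong (_* d E) (J-diagonal r E E∈P) ⟨
    J-coeff r E (bits E) * d E                                     ≡⟨ ∑-allSubsets-single (bits E) _ off-diagonal ⟨
    (∑[ H ← allSubsets (nEdges v) ] (J-coeff r E H * d (mkE H)))    ≡⟨ J-d E ⟨
    J r y E - J r y′ E                                             ≡⟨ cong (_- J r y′ E) (J-eq E E∈P) ⟩
    J r y′ E - J r y′ E                                            ≡⟨ +-inverseʳ (J r y′ E) ⟩
    0ℚ                                                             ∎)
    where
    off-diagonal : ∀ H → H ≢ bits E → J-coeff r E H * d (mkE H) ≡ 0ℚ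
    off-diagonal H H≢E with inP (mkE {v} H) in H∈P | H ⊆? bits E
    ... | true  | yes H⊆E =
      trans (cong (λ t → w * (t - y′ (mkE H))) (below n (mkE H) |H|<n H∈P))
            (trans (cong (w *_) (+-inverseʳ (y′ (mkE H)))) (*-zeroʳ w))
      where
      w = 1ℚ * r ^ℚ (size E ∸ ∣ H ∣)
      |H|<n = ℕ.<-≤-trans (⊆∧≢⇒∣p∣<∣q∣ H⊆E H≢E) (ℕ.≤-pred |E|≤n)
    ... | true  | no _  = trans (cong (_* d (mkE H)) (*-zeroˡ (r ^ℚ (size E ∸ ∣ H ∣)))) (*-zeroˡ (d (mkE H)))
    ... | false | _     = trans (cong (_* d (mkE H)) (*-zeroˡ (r ^ℚ (size E ∸ ∣ H ∣)))) (*-zeroˡ (d (mkE H)))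

T⇔T⇒≡ : ∀ {x y} → (T x → T y) → (T y → T x) → x ≡ y
T⇔T⇒≡ {false} {false} _ _ = refl
T⇔T⇒≡ {false} {true}  _ g = ⊥-elim (g _)
T⇔T⇒≡ {true}  {false} f _ = ⊥-elim (f _)
T⇔T⇒≡ {true}  {true}  _ _ = refl

T-anyᵇ⁺ : ∀ (p : X → Bool) {x xs} → x ∈ₗ xs → T (p x) → T (anyᵇ p xs)
T-anyᵇ⁺ p (Any.here refl)               px = from T-∨ (inj₁ px)
T-anyᵇ⁺ p {xs = y ∷ _} (Any.there x∈xs) px = from (T-∨ {p y}) (inj₂ (T-anyᵇ⁺ p x∈xs px))

T-anyᵇ⁻ : ∀ (p : X → Bool) xs → T (anyᵇ p xs) → ∃[ x ] T (p x)
T-anyᵇ⁻ p (x ∷ xs) any with to (T-∨ {p x}) any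
... | inj₁ px  = x , px
... | inj₂ any′ = T-anyᵇ⁻ p xs any′

allᵇ-false⁻ : ∀ (p : X → Bool) xs → allᵇ p xs ≡ false → ∃[ x ] p x ≡ false
allᵇ-false⁻ p (x ∷ xs) all≡false with p x in px
... | false = x , px
... | true  = allᵇ-false⁻ p xs all≡false

allᵇ-allFin-suc : ∀ {m} (q : Fin (suc m) → Bool) → allᵇ q (allFin (suc m)) ≡ q zero ∧ allᵇ (q ∘ suc) (allFin m)
allᵇ-allFin-suc {m} q = begin
  allᵇ q (allFin (suc m))                 ≡⟨ cong (allᵇ q) (allFin-suc m) ⟩
  q zero ∧ allᵇ q (List.map suc (allFin m)) ≡⟨ cong (q zero ∧_) (List.foldr-map _ suc true (allFin m)) ⟩
  q zero ∧ allᵇ (q ∘ suc) (allFin m)        ∎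
  where open ≡-Reasoning

𝟙-allᵇ : ∀ {m} (E : Subset m) (p : Fin m → Bool) →
         𝟙 (allᵇ (λ k → not (Vec.lookup E k) ∨ p k) (allFin m)) ≡ ∏ E (𝟙 ∘ p)
𝟙-allᵇ []              p = refl
𝟙-allᵇ (outside ∷ E) p = trans (cong 𝟙 (allᵇ-allFin-suc (λ k → not (Vec.lookup (outside ∷ E) k) ∨ p k)))
                               (𝟙-allᵇ E (p ∘ suc))
𝟙-allᵇ {suc m} (inside ∷ E) p = begin
  𝟙 (allᵇ q (allFin (suc m)))                         ≡⟨ cong 𝟙 (allᵇ-allFin-suc q) ⟩
  𝟙 (p zero ∧ allᵇ (q ∘ suc) (allFin m))             ≡⟨ 𝟙-∧ (p zero) _ ⟩
  𝟙 (p zero) * 𝟙 (allᵇ (q ∘ suc) (allFin m))         ≡⟨ cong (𝟙 (p zero) *_) (𝟙-allᵇ E (p ∘ suc)) ⟩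
  𝟙 (p zero) * ∏ E (𝟙 ∘ p ∘ suc)                     ∎
  where
  open ≡-Reasoning
  q = λ k → not (Vec.lookup (inside ∷ E) k) ∨ p k

anyᵇ-cong : ∀ {p q : X → Bool} xs → (∀ x → p x ≡ q x) → anyᵇ p xs ≡ anyᵇ q xs
anyᵇ-cong []       eq = refl
anyᵇ-cong (x ∷ xs) eq = cong₂ _∨_ (eq x) (anyᵇ-cong xs eq)

count-cong : ∀ {p q : X → Bool} xs → (∀ x → p x ≡ q x) → count p xs ≡ count q xs
count-cong                 []       eq = refl
count-cong {p = p} {q = q} (x ∷ xs) eq with p x | q x | eq x
... | true  | .true  | refl = cong suc (count-cong xs eq)
... | false | .false | refl = count-cong xs eq

count-mono : ∀ {p q : X → Bool} → (∀ x → T (p x) → T (q x)) → ∀ xs → count p xs ≤ count q xs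
count-mono                 p⇒q []       = z≤n
count-mono {p = p} {q = q} p⇒q (x ∷ xs) with p x | q x | p⇒q x
... | true  | true  | _  = s≤s (count-mono p⇒q xs)
... | true  | false | px⇒qx = ⊥-elim (px⇒qx _)
... | false | true  | _  = ℕ.m≤n⇒m≤1+n (count-mono p⇒q xs)
... | false | false | _  = count-mono p⇒q xs

count-< : ∀ {p q : X → Bool} → (∀ x → T (p x) → T (q x)) →
          ∀ {y xs} → y ∈ₗ xs → ¬ T (p y) → T (q y) → count p xs < count q xs
count-< {p = p} {q = q} p⇒q {y} {_ ∷ xs} (Any.here refl) ¬py qy with p y | q y
... | true  | _     = ⊥-elim (¬py _)
... | false | false = ⊥-elim qy
... | false | true  = s≤s (count-mono p⇒q xs)
count-< {p = p} {q = q} p⇒q {xs = x ∷ xs} (Any.there y∈xs) ¬py qy with p x | q x | p⇒q x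
... | true  | true  | _  = s≤s (count-< p⇒q y∈xs ¬py qy)
... | true  | false | px⇒qx = ⊥-elim (px⇒qx _)
... | false | true  | _  = ℕ.m<n⇒m<1+n (count-< p⇒q y∈xs ¬py qy)
... | false | false | _  = count-< p⇒q y∈xs ¬py qy

count-allFin-≤ : ∀ {n} (p : Fin n → Bool) → count p (allFin n) ≤ n
count-allFin-≤ {n} p = subst (count p (allFin n) ≤_) (List.length-tabulate id)
                             (List.length-filter (λ x → Bool.T? (p x)) (allFin n))

-- Walks and connectivity

module _ {v : ℕ} where

  src tgt : Fin (nEdges v) → Fin v
  src k = proj₁ (edge v k)
  tgt k = proj₂ (edge v k)

  Joins : Fin (nEdges v) → Fin v → Fin v → Set
  Joins k a b = (src k ≡ a × tgt k ≡ b) ⊎ (src k ≡ b × tgt k ≡ a)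

  adj⁺ : ∀ E {k a b} → T (k ∈E E) → Joins k a b → T (adj {v} E a b)
  adj⁺ E {k} {a} {b} k∈E joins =
    T-anyᵇ⁺ _ (∈-allFin k) (from (T-∧ {k ∈E E}) (k∈E , from (T-∨ {src k ==ᶠ a ∧ tgt k ==ᶠ b}) (ends joins)))
    where
    ends : ∀ {a b} → Joins k a b →
           T (src k ==ᶠ a ∧ tgt k ==ᶠ b) ⊎ T (src k ==ᶠ b ∧ tgt k ==ᶠ a)
    ends (inj₁ (refl , refl)) = inj₁ (from (T-∧ {src k ==ᶠ src k}) (fromWitness refl , fromWitness refl))
    ends (inj₂ (refl , refl)) = inj₂ (from (T-∧ {src k ==ᶠ src k}) (fromWitness refl , fromWitness refl))

  ==ᶠ-∧⁻ : ∀ {a b c d : Fin v} → T (a ==ᶠ b ∧ c ==ᶠ d) → a ≡ b × c ≡ d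
  ==ᶠ-∧⁻ {a} {b} t = toWitness (proj₁ (to (T-∧ {a ==ᶠ b}) t)) , toWitness (proj₂ (to (T-∧ {a ==ᶠ b}) t))

  adj⁻ : ∀ E {a b} → T (adj {v} E a b) → ∃[ k ] (T (k ∈E E) × Joins k a b)
  adj⁻ E {a} {b} any with T-anyᵇ⁻ _ (allFin (nEdges v)) any
  ... | k , t with to T-∧ t
  ... | k∈E , ends with to T-∨ ends
  ... | inj₁ e = k , k∈E , inj₁ (==ᶠ-∧⁻ e)
  ... | inj₂ e = k , k∈E , inj₂ (==ᶠ-∧⁻ e)

  Joins-sym : ∀ {k a b} → Joins k a b → Joins k b a
  Joins-sym (inj₁ ends) = inj₂ ends
  Joins-sym (inj₂ ends) = inj₁ ends

  adj-sym : ∀ E {a b} → T (adj {v} E a b) → T (adj E b a)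
  adj-sym E a~b with adj⁻ E a~b
  ... | k , k∈E , joins = adj⁺ E k∈E (Joins-sym joins)

  adj-mono : ∀ {E E′} → (∀ k → T (k ∈E E′) → T (k ∈E E)) → ∀ {a b} → T (adj {v} E′ a b) → T (adj E a b)
  adj-mono {E} {E′} E′⊆E a~b with adj⁻ E′ a~b
  ... | k , k∈E′ , joins = adj⁺ E (E′⊆E k k∈E′) joins

  reach-refl : ∀ E n a → T (reachK {v} E n a a)
  reach-refl E zero    a = fromWitness refl
  reach-refl E (suc n) a = from T-∨ (inj₁ (reach-refl E n a))

  reach-suc : ∀ E n {a b} → T (reachK {v} E n a b) → T (reachK E (suc n) a b)
  reach-suc E n reach = from T-∨ (inj₁ reach)

  reach-step : ∀ E n {a l b} → T (reachK {v} E n a l) → T (adj E l b) → T (reachK E (suc n) a b)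
  reach-step E n {l = l} reach l~b = from T-∨ (inj₂ (T-anyᵇ⁺ _ (∈-allFin l) (from T-∧ (reach , l~b))))

  reach-ind : ∀ E {a} (P : Fin v → Set) → P a → (∀ {l b} → P l → T (adj E l b) → P b) →
              ∀ n {b} → T (reachK E n a b) → P b
  reach-ind E P Pa step zero    reach = subst P (toWitness reach) Pa
  reach-ind E P Pa step (suc n) reach with to T-∨ reach
  ... | inj₁ reach′ = reach-ind E P Pa step n reach′
  ... | inj₂ any with T-anyᵇ⁻ _ (allFin v) any
  ... | l , t = step (reach-ind E P Pa step n (proj₁ (to T-∧ t))) (proj₂ (to T-∧ t))

  -- The vertices reachable from a in at most n steps form a set that grows strictly until it
  -- stabilises; since it has at most v elements, it is stable from n = v on.
  Stable : EdgeSet v → Fin v → ℕ → Set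
  Stable E a n = ∀ b → reachK E (suc n) a b ≡ reachK E n a b

  stable-suc : ∀ E a n → Stable E a n → Stable E a (suc n)
  stable-suc E a n stable b =
    cong₂ _∨_ (stable b) (anyᵇ-cong (allFin v) (λ l → cong (_∧ adj E l b) (stable l)))

  stable-or-growing : ∀ E a n → Stable E a n ⊎ n < count (reachK E n a) (allFin v)
  stable-or-growing E a zero =
    inj₂ (ℕ.≤-<-trans z≤n (count-< {p = λ _ → false} (λ _ ()) (∈-allFin a) (λ ()) (reach-refl E zero a)))
  stable-or-growing E a (suc n) with stable-or-growing E a n
  ... | inj₁ stable = inj₁ (stable-suc E a n stable)
  ... | inj₂ growing with Fin.all? (λ b → reachK E (suc n) a b Bool.≟ reachK E n a b)
  ...   | yes stable = inj₁ (stable-suc E a n stable)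
  ...   | no unstable with Fin.¬∀⟶∃¬ v _ (λ b → reachK E (suc n) a b Bool.≟ reachK E n a b) unstable
  ...     | b , changed = inj₂ (ℕ.≤-trans (s≤s growing)
                                  (count-< (λ _ → reach-suc E n) (∈-allFin b) (proj₁ new) (proj₂ new)))
    where
    new : ¬ T (reachK E n a b) × T (reachK E (suc n) a b)
    new with reachK E n a b | reachK E (suc n) a b | reach-suc E n {a} {b}
    ... | false | true  | _ = (λ ()) , _
    ... | false | false | _ = ⊥-elim (changed refl)
    ... | true  | true  | _ = ⊥-elim (changed refl)
    ... | true  | false | old⇒new = ⊥-elim (old⇒new _)

  stable-at-v : ∀ E a → Stable E a v
  stable-at-v E a with stable-or-growing E a v
  ... | inj₁ stable = stable
  ... | inj₂ v<count = ⊥-elim (ℕ.<-irrefl refl (ℕ.<-≤-trans v<count (count-allFin-≤ (reachK E v a))))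

  conn-step : ∀ E {a l b} → T (connected E a l) → T (adj E l b) → T (connected E a b)
  conn-step E {a} {b = b} a~l l~b = subst T (stable-at-v E a b) (reach-step E v a~l l~b)

  conn-trans : ∀ E {a l b} → T (connected E a l) → T (connected E l b) → T (connected E a b)
  conn-trans E {a} a~l = reach-ind E (T ∘ connected E a) a~l (conn-step E) v

  conn-sym : ∀ E {a b} → T (connected E a b) → T (connected E b a)
  conn-sym E {a} = reach-ind E (λ x → T (connected E x a)) (reach-refl E v a)
    (λ l~a l~b → conn-trans E (conn-step E (reach-refl E v _) (adj-sym E l~b)) l~a) v

  c-cong : ∀ {E E′} → (∀ a b → connected E a b ≡ connected E′ a b) → c E ≡ c E′
  c-cong eq = count-cong (allFin v) λ i →
    cong not (anyᵇ-cong (allFin v) (λ j → cong ((j <ᵇ i) ∧_) (eq j i)))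

  ∈-remove⁻ : ∀ E k {j} → T (j ∈E remove {v} E k) → T (j ∈E E)
  ∈-remove⁻ E k {j} j∈E′ with j Fin.≟ k
  ... | yes j≡k  = ⊥-elim (subst T (trans (cong (Vec.lookup (bits E [ k ]≔ false)) j≡k)
                                          (Vec.lookup∘update k (bits E) false)) j∈E′)
  ... | no j≢k   = subst T (Vec.lookup∘update′ j≢k (bits E) false) j∈E′

  ∈-remove⁺ : ∀ E k {j} → j ≢ k → T (j ∈E E) → T (j ∈E remove {v} E k)
  ∈-remove⁺ E k j≢k = subst T (sym (Vec.lookup∘update′ j≢k (bits E) false))

  connected-remove : ∀ E k → T (k ∈E E) → T (connected (remove E k) (src k) (tgt k)) →
                     ∀ a b → connected E a b ≡ connected (remove {v} E k) a b
  connected-remove E k k∈E bypass a b = T⇔T⇒≡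
    (reach-ind E (T ∘ connected E′ a) (reach-refl E′ v a) step v)
    (reach-ind E′ (T ∘ connected E a) (reach-refl E v a)
               (λ a~l l~b → conn-step E a~l (adj-mono {E} {E′} (λ j → ∈-remove⁻ E k) l~b)) v)
    where
    E′ = remove E k
    step : ∀ {l b} → T (connected E′ a l) → T (adj E l b) → T (connected E′ a b)
    step a~l l~b with adj⁻ E l~b
    ... | j , j∈E , joins with j Fin.≟ k
    ...   | no j≢k = conn-step E′ a~l (adj⁺ E′ (∈-remove⁺ E k j≢k j∈E) joins)
    ...   | yes refl with joins
    ...     | inj₁ (refl , refl) = conn-trans E′ a~l bypass
    ...     | inj₂ (refl , refl) = conn-trans E′ a~l (conn-sym E′ bypass)

-- An isthmus is encoded by a cut: `side` separates the ends of `bridge` and no other edge of H crosses it.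

record Isthmus {v} (H : EdgeSet v) : Set where
  field
    bridge      : Fin (nEdges v)
    bridge∈H    : bridge ∈ bits H
    side        : Fin v → Bool
    src-inside  : side (src bridge) ≡ true
    tgt-outside : side (tgt bridge) ≡ false
    uncut       : ∀ {j} → j ∈ bits (remove H bridge) → side (src j) ≡ side (tgt j)

∉P⇒Isthmus : ∀ {v} (H : EdgeSet v) → inP H ≡ false → Isthmus H
∉P⇒Isthmus {v} H H∉P with allᵇ-false⁻ _ (allFin (nEdges v)) H∉P
... | k , not-isthmus-free = record
  { bridge      = k
  ; bridge∈H    = Vec.lookup⇒[]= k (bits H) k∈H
  ; side        = connected H′ (src k)
  ; src-inside  = to T-≡ (reach-refl H′ v (src k))
  ; tgt-outside = tgt-outside
  ; uncut       = λ {j} j∈H′ → T⇔T⇒≡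
      (λ s~src → conn-step H′ s~src (adj⁺ H′ (from T-≡ (Vec.[]=⇒lookup j∈H′)) (inj₁ (refl , refl))))
      (λ s~tgt → conn-step H′ s~tgt (adj⁺ H′ (from T-≡ (Vec.[]=⇒lookup j∈H′)) (inj₂ (refl , refl))))
  }
  where
  H′ = remove H k
  k∈H : k ∈E H ≡ true
  k∈H = trans (sym (not-involutive _)) (cong not (∨-conicalˡ (not (k ∈E H)) (c H ==ℕ c H′) not-isthmus-free))
  c-changes : c H ≢ c H′
  c-changes eq = subst T (∨-conicalʳ (not (k ∈E H)) (c H ==ℕ c H′) not-isthmus-free) (fromWitness eq)
  tgt-outside : connected H′ (src k) (tgt k) ≡ false
  tgt-outside with connected H′ (src k) (tgt k) in bypass
  ... | false = refl
  ... | true  = ⊥-elim (c-changes (c-cong (connected-remove H k (from T-≡ k∈H) (from T-≡ bypass))))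

-- Translations in a finite Abelian group

module _ {a ℓ} (G : AbelianGroup a ℓ) where
  open AbelianGroup G
  open AbelianGroupProperties G using (⁻¹-∙-comm)
  open CommutativeSemigroupProperties commutativeSemigroup using (interchange)
  open SetoidReasoning setoid

  ∙-⁻¹-cancelʳ : ∀ x y z → (x ∙ z) ∙ (y ∙ z) ⁻¹ ≈ x ∙ y ⁻¹
  ∙-⁻¹-cancelʳ x y z = begin
    (x ∙ z) ∙ (y ∙ z) ⁻¹     ≈⟨ ∙-congˡ (⁻¹-∙-comm y z) ⟨
    (x ∙ z) ∙ (y ⁻¹ ∙ z ⁻¹)  ≈⟨ interchange x z (y ⁻¹) (z ⁻¹) ⟩
    (x ∙ y ⁻¹) ∙ (z ∙ z ⁻¹)  ≈⟨ ∙-congˡ (inverseʳ z) ⟩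
    (x ∙ y ⁻¹) ∙ ε           ≈⟨ identityʳ _ ⟩
    x ∙ y ⁻¹                 ∎

module _ (F : FiniteAbelianGroup) where
  open FiniteAbelianGroup F hiding (_-_; refl; trans) renaming (sym to ≈-sym)

  index : Carrier → Fin f
  index x = proj₁ (enum-surj x)

  translate : Carrier → Fin f → Fin f
  translate c a = index (enum a ∙ c)

  enum-translate : ∀ c a → enum (translate c a) ≈ enum a ∙ c
  enum-translate c a = proj₂ (enum-surj (enum a ∙ c))

  translate-cancel : ∀ {c d} → c ∙ d ≈ ε → ∀ a → translate d (translate c a) ≡ a
  translate-cancel {c} {d} c∙d≈ε a = enum-inj _ _ (begin
    enum (translate d (translate c a)) ≈⟨ enum-translate d _ ⟩
    enum (translate c a) ∙ d           ≈⟨ ∙-congʳ (enum-translate c a) ⟩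
    (enum a ∙ c) ∙ d                   ≈⟨ assoc _ _ _ ⟩
    enum a ∙ (c ∙ d)                   ≈⟨ ∙-congˡ c∙d≈ε ⟩
    enum a ∙ ε                         ≈⟨ identityʳ _ ⟩
    enum a                             ∎)
    where open SetoidReasoning setoid

  ∑-translate : ∀ c (h : Fin f → ℚ) → (∑[ a ← allFin f ] h (translate c a)) ≡ ∑ (allFin f) h
  ∑-translate c = ∑-allFin-permute (translate c) (translate (c ⁻¹))
                    (translate-cancel (inverseˡ c)) (translate-cancel (inverseʳ c))

  IsMean : (Carrier → Bool) → ℚ → Set
  IsMean B β = (∑[ a ← allFin f ] (𝟙 (B (enum a)) - β)) ≡ 0ℚ

  IsMean-translate : ∀ {B β} → (∀ x y → x ≈ y → B x ≡ B y) → IsMean B β →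
                     ∀ d → (∑[ a ← allFin f ] (𝟙 (B (enum a ∙ d)) - β)) ≡ 0ℚ
  IsMean-translate {B} {β} B-resp mean d = begin
    (∑[ a ← allFin f ] (𝟙 (B (enum a ∙ d)) - β))
      ≡⟨ ∑-cong (allFin f) (λ a → cong (λ b → 𝟙 b - β) (B-resp _ _ (≈-sym (enum-translate d a)))) ⟩
    (∑[ a ← allFin f ] (𝟙 (B (enum (translate d a))) - β))
      ≡⟨ ∑-translate d (λ a → 𝟙 (B (enum a)) - β) ⟩
    (∑[ a ← allFin f ] (𝟙 (B (enum a)) - β))
      ≡⟨ mean ⟩
    0ℚ ∎
    where open ≡-Reasoning

  density-isMean : ∀ A → IsMean A (density F A)
  density-isMean A = begin
    (∑[ a ← allFin f ] (𝟙 (A (enum a)) - α))  ≡⟨ ∑-distrib-- (allFin f) _ (λ _ → α) ⟩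
    s - (∑[ a ← allFin f ] α)                ≡⟨ cong (λ t → s - (∑[ a ← allFin f ] t)) α≡s/f ⟩
    s - (∑[ a ← allFin f ] (s * u))          ≡⟨ cong (λ t → s - t) (∑-*ˡ (allFin f) s (λ _ → u)) ⟩
    s - s * (∑[ a ← allFin f ] u)            ≡⟨ cong (λ t → s - s * t) (∑-allFin-1/n f) ⟩
    s - s * 1ℚ                               ≡⟨ solve 1 (λ s → s :- s :* con 1ℚ := con 0ℚ) refl s ⟩
    0ℚ                                       ∎
    where
    open ≡-Reasoning
    open +-*-Solver
    instance _ = nonZeroOfFin (index ε)
    α = density F A
    u = ℤ.+ 1 / f
    s = ∑[ a ← allFin f ] 𝟙 (A (enum a))
    α≡s/f : α ≡ s * u
    α≡s/f = trans (count-/ (λ a → A (enum a)) (allFin f) f) (∑-*ʳ (allFin f) u (λ a → 𝟙 (A (enum a))))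

  compl-isMean : ∀ {B β} → IsMean B β → IsMean (compl F B) (1ℚ - β)
  compl-isMean {B} {β} mean = begin
    (∑[ a ← allFin f ] (𝟙 (not (B (enum a))) - (1ℚ - β)))  ≡⟨ ∑-cong (allFin f) (λ a → 𝟙-not (B (enum a)) β) ⟩
    (∑[ a ← allFin f ] (- (𝟙 (B (enum a)) - β)))           ≡⟨ ∑-neg (allFin f) _ ⟩
    - (∑[ a ← allFin f ] (𝟙 (B (enum a)) - β))             ≡⟨ cong -_ mean ⟩
    0ℚ                                                     ∎
    where open ≡-Reasoning

-- On P_V, moment is the vector J_β⁻¹ Γ^B of the theorem.

module Moment (F : FiniteAbelianGroup) (B : FiniteAbelianGroup.Carrier F → Bool) (β : ℚ) (v : ℕ) where
  open FiniteAbelianGroup F hiding (_-_; refl; sym) renaming (reflexive to ≈-reflexive; trans to ≈-trans)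

  diff : Fin (nEdges v) → Vec (Fin f) v → Carrier
  diff k X = enum (Vec.lookup X (src k)) − enum (Vec.lookup X (tgt k))

  χ : Fin (nEdges v) → Vec (Fin f) v → ℚ
  χ k X = 𝟙 (B (diff k X)) - β

  instance
    f^v≢0 : NonZero (f ℕ.^ v)
    f^v≢0 = ℕ.m^n≢0 f v {{nonZeroOfFin (index F ε)}}

  moment : Vector v
  moment H = ∑[ X ← allVecs v f ] (∏ (bits H) (λ k → χ k X) * (ℤ.+ 1 / f ℕ.^ v))

  𝟙-goodFor-expand : ∀ E X → 𝟙 (goodFor F B E X) ≡ ∑ (allSubsets (nEdges v)) (binomialTerm β (bits E) (λ k → χ k X))
  𝟙-goodFor-expand E X = begin
    𝟙 (goodFor F B E X)                   ≡⟨ 𝟙-allᵇ (bits E) (λ k → B (diff k X)) ⟩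
    ∏ (bits E) (λ k → 𝟙 (B (diff k X)))  ≡⟨ ∏-cong (bits E) (λ {k} _ → centre (𝟙 (B (diff k X)))) ⟩
    ∏ (bits E) (λ k → β + χ k X)          ≡⟨ ∏-+-expand (bits E) β (λ k → χ k X) ⟩
    ∑ (allSubsets (nEdges v)) (binomialTerm β (bits E) (λ k → χ k X)) ∎
    where
    open ≡-Reasoning
    open +-*-Solver
    centre : ∀ b → b ≡ β + (b - β)
    centre b = solve 2 (λ b β → b := β :+ (b :- β)) refl b β

  Γ-expand : ∀ E → Γ F B E
    ≡ (∑[ H ← allSubsets (nEdges v) ] (𝟙 (does (H ⊆? bits E)) * β ^ℚ (size E ∸ ∣ H ∣) * moment (mkE H)))
  Γ-expand E = begin
    Γ F B E
      ≡⟨ count-/ (goodFor F B E) (allVecs v f) (f ℕ.^ v) ⟩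
    (∑[ X ← allVecs v f ] (𝟙 (goodFor F B E X) * w))
      ≡⟨ ∑-cong (allVecs v f) (λ X → cong (_* w) (𝟙-goodFor-expand E X)) ⟩
    (∑[ X ← allVecs v f ] ((∑[ H ← allSubsets m ] term X H) * w))
      ≡⟨ ∑-cong (allVecs v f) (λ X → ∑-*ʳ (allSubsets m) w (term X)) ⟨
    (∑[ X ← allVecs v f ] ∑[ H ← allSubsets m ] (term X H * w))
      ≡⟨ ∑-comm (allVecs v f) (allSubsets m) _ ⟩
    (∑[ H ← allSubsets m ] ∑[ X ← allVecs v f ] (term X H * w))
      ≡⟨ ∑-cong (allSubsets m) (λ H → trans (∑-cong (allVecs v f) (regroup H)) (∑-*ˡ (allVecs v f) (coeff H) _)) ⟩
    (∑[ H ← allSubsets m ] (coeff H * moment (mkE H))) ∎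
    where
    open ≡-Reasoning
    m = nEdges v
    w = ℤ.+ 1 / f ℕ.^ v
    coeff : Subset m → ℚ
    coeff H = 𝟙 (does (H ⊆? bits E)) * β ^ℚ (size E ∸ ∣ H ∣)
    term : Vec (Fin f) v → Subset m → ℚ
    term X = binomialTerm β (bits E) (λ k → χ k X)
    regroup : ∀ H X → term X H * w ≡ coeff H * (∏ H (λ k → χ k X) * w)
    regroup H X = solve 4 (λ t p q w → (t :* (p :* q)) :* w := (t :* p) :* (q :* w)) refl
                          (𝟙 (does (H ⊆? bits E))) (β ^ℚ (size E ∸ ∣ H ∣)) (∏ H (λ k → χ k X)) w
      where open +-*-Solver

  module _ (B-resp : ∀ x y → x ≈ y → B x ≡ B y) (β-mean : IsMean F B β) where

    module _ {H : EdgeSet v} (I : Isthmus H) where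
      open Isthmus I
      open CommutativeSemigroupProperties commutativeSemigroup using (xy∙z≈y∙xz)

      move : Carrier → Fin v → Fin f → Fin f
      move c i = if side i then translate F c else id

      move-cancel : ∀ {c d} → c ∙ d ≈ ε → ∀ i a → move d i (move c i a) ≡ a
      move-cancel c∙d≈ε i a with side i
      ... | true  = translate-cancel F c∙d≈ε a
      ... | false = refl

      shift : Carrier → Vec (Fin f) v → Vec (Fin f) v
      shift c X = Vec.tabulate (λ i → move c i (Vec.lookup X i))

      shift-inside : ∀ c X {i} → side i ≡ true → enum (Vec.lookup (shift c X) i) ≈ enum (Vec.lookup X i) ∙ c
      shift-inside c X {i} i-inside
        rewrite Vec.lookup∘tabulate (λ i → move c i (Vec.lookup X i)) i | i-inside = enum-translate F c _

      shift-outside : ∀ c X {i} → side i ≡ false → Vec.lookup (shift c X) i ≡ Vec.lookup X i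
      shift-outside c X {i} i-outside
        rewrite Vec.lookup∘tabulate (λ i → move c i (Vec.lookup X i)) i | i-outside = refl

      diff-shift-uncut : ∀ c X {j} → j ∈ bits (remove H bridge) → diff j (shift c X) ≈ diff j X
      diff-shift-uncut c X {j} j∈H′ with side (src j) in s | side (tgt j) in t | uncut j∈H′
      ... | true  | true  | _ = ≈-trans (∙-cong (shift-inside c X s) (⁻¹-cong (shift-inside c X t)))
                                        (∙-⁻¹-cancelʳ abGroup _ _ c)
      ... | false | false | _ = ≈-reflexive (cong₂ (λ a b → enum a − enum b) (shift-outside c X s) (shift-outside c X t))

      diff-shift-bridge : ∀ c X → diff bridge (shift c X) ≈ c ∙ diff bridge X
      diff-shift-bridge c X = ≈-trans
        (∙-cong (shift-inside c X src-inside) (⁻¹-cong (≈-reflexive (cong enum (shift-outside c X tgt-outside)))))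
        (xy∙z≈y∙xz _ c _)

      ∏χ-shift : ∀ c X → ∏ (bits H) (λ k → χ k (shift c X))
                         ≡ (𝟙 (B (c ∙ diff bridge X)) - β) * ∏ (bits (remove H bridge)) (λ k → χ k X)
      ∏χ-shift c X = trans (∏-remove bridge∈H _) (cong₂ _*_
        (cong (λ b → 𝟙 b - β) (B-resp _ _ (diff-shift-bridge c X)))
        (∏-cong (bits (remove H bridge)) (λ j∈H′ → cong (λ b → 𝟙 b - β) (B-resp _ _ (diff-shift-uncut c X j∈H′)))))

      ∑∏χ-isthmus : (∑[ X ← allVecs v f ] ∏ (bits H) (λ k → χ k X)) ≡ 0ℚ
      ∑∏χ-isthmus = begin
        S                                                ≡⟨ *-identityˡ S ⟨
        1ℚ * S                                           ≡⟨ cong (_* S) (∑-allFin-1/n f) ⟨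
        (∑[ a ← allFin f ] u) * S                        ≡⟨ ∑-*ʳ (allFin f) S (λ _ → u) ⟨
        (∑[ a ← allFin f ] (u * S))
                                          ≡⟨ ∑-cong (allFin f) (λ a → cong (u *_) (shift-invariant (enum a))) ⟨
        (∑[ a ← allFin f ] (u * ∑ (allVecs v f) (P ∘ shift (enum a))))
                                                         ≡⟨ ∑-*ˡ (allFin f) u _ ⟩
        u * (∑[ a ← allFin f ] ∑ (allVecs v f) (P ∘ shift (enum a)))
                                                         ≡⟨ cong (u *_) (∑-comm (allFin f) (allVecs v f) _) ⟩
        u * (∑[ X ← allVecs v f ] ∑[ a ← allFin f ] P (shift (enum a) X))
                                                         ≡⟨ cong (u *_) (∑-zero (allVecs v f) averages-out) ⟩
        u * 0ℚ                                           ≡⟨ *-zeroʳ u ⟩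
        0ℚ                                               ∎
        where
        open ≡-Reasoning
        instance _ = nonZeroOfFin (index F ε)
        u = ℤ.+ 1 / f
        P : Vec (Fin f) v → ℚ
        P X = ∏ (bits H) (λ k → χ k X)
        S = ∑ (allVecs v f) P
        shift-invariant : ∀ c → ∑ (allVecs v f) (P ∘ shift c) ≡ S
        shift-invariant c = ∑-allVecs-permute (move c) (move (c ⁻¹))
                              (move-cancel (inverseˡ c)) (move-cancel (inverseʳ c)) P
        averages-out : ∀ X → (∑[ a ← allFin f ] P (shift (enum a) X)) ≡ 0ℚ
        averages-out X = begin
          (∑[ a ← allFin f ] P (shift (enum a) X))            ≡⟨ ∑-cong (allFin f) (λ a → ∏χ-shift (enum a) X) ⟩
          (∑[ a ← allFin f ] ((𝟙 (B (enum a ∙ diff bridge X)) - β) * R))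
                                                              ≡⟨ ∑-*ʳ (allFin f) R _ ⟩
          (∑[ a ← allFin f ] (𝟙 (B (enum a ∙ diff bridge X)) - β)) * R
                                                              ≡⟨ cong (_* R) (IsMean-translate F B-resp β-mean (diff bridge X)) ⟩
          0ℚ * R                                              ≡⟨ *-zeroˡ R ⟩
          0ℚ                                                  ∎
          where R = ∏ (bits (remove H bridge)) (λ k → χ k X)

      moment-isthmus : moment H ≡ 0ℚ
      moment-isthmus = trans (∑-*ʳ (allVecs v f) _ _) (trans (cong (_* _) ∑∏χ-isthmus) (*-zeroˡ (ℤ.+ 1 / f ℕ.^ v)))

    moment-restrict : ∀ (E : EdgeSet v) H → 𝟙 (does (H ⊆? bits E)) * β ^ℚ (size E ∸ ∣ H ∣) * moment (mkE H)
                              ≡ J-coeff β E H * moment (mkE H)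
    moment-restrict E H with inP (mkE {v} H) in H∈P | H ⊆? bits E
    ... | true  | yes _ = refl
    ... | true  | no _  = refl
    ... | false | no _  = refl
    ... | false | yes _ = trans (cong (1ℚ * p *_) vanishes)
                        (trans (*-zeroʳ (1ℚ * p)) (sym (trans (cong (0ℚ * p *_) vanishes) (*-zeroʳ (0ℚ * p)))))
      where
      p = β ^ℚ (size E ∸ ∣ H ∣)
      vanishes : moment (mkE H) ≡ 0ℚ
      vanishes = moment-isthmus (∉P⇒Isthmus (mkE H) H∈P)

    Γ≡J-moment : ∀ E → Γ F B E ≡ J β moment E
    Γ≡J-moment E = begin
      Γ F B E                                                          ≡⟨ Γ-expand E ⟩
      (∑[ H ← allSubsets (nEdges v) ] (𝟙 (does (H ⊆? bits E)) * β ^ℚ (size E ∸ ∣ H ∣) * moment (mkE H)))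
                                                                       ≡⟨ ∑-cong (allSubsets (nEdges v)) (moment-restrict E) ⟩
      (∑[ H ← allSubsets (nEdges v) ] (J-coeff β E H * moment (mkE H))) ≡⟨ J-∑ β moment E ⟨
      J β moment E                                                     ∎
      where open ≡-Reasoning

moment-compl : ∀ F B β v E → Moment.moment F (compl F B) (1ℚ - β) v E
                             ≡ (- 1ℚ) ^ℚ size E * Moment.moment F B β v E
moment-compl F B β v E = begin
  (∑[ X ← allVecs v f ] (∏ (bits E) (λ k → 𝟙 (not (B (diff k X))) - (1ℚ - β)) * w))
    ≡⟨ ∑-cong (allVecs v f) (λ X → cong (_* w) (∏-cong (bits E) (λ {k} _ → 𝟙-not (B (diff k X)) β))) ⟩
  (∑[ X ← allVecs v f ] (∏ (bits E) (λ k → - χ k X) * w))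
    ≡⟨ ∑-cong (allVecs v f) (λ X → trans (cong (_* w) (∏-neg (bits E) (λ k → χ k X)))
                                         (*-assoc ((- 1ℚ) ^ℚ size E) _ w)) ⟩
  (∑[ X ← allVecs v f ] ((- 1ℚ) ^ℚ size E * (∏ (bits E) (λ k → χ k X) * w)))
    ≡⟨ ∑-*ˡ (allVecs v f) ((- 1ℚ) ^ℚ size E) _ ⟩
  (- 1ℚ) ^ℚ size E * moment E ∎
  where
  open ≡-Reasoning
  open FiniteAbelianGroup F using (f)
  open Moment F B β v
  w = ℤ.+ 1 / f ℕ.^ v

open FiniteAbelianGroup using (Carrier; _≈_; _⁻¹)

mainTheorem1 : (F : FiniteAbelianGroup) (A : Carrier F → Bool)
    → (∀ x y → _≈_ F x y → A x ≡ A y)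
    → (∀ x → A (_⁻¹ F x) ≡ A x)
    → (v : ℕ) (y z : Vector v)
    → (∀ E → InP E → J (density F A) y E ≡ Γ F A E)
    → (∀ E → InP E → J (1ℚ - density F A) z E ≡ Γ F (compl F A) E)
    → ∀ E → InP E → y E ≡ signE z E
mainTheorem1 F A A-resp _ v y z y-solves z-solves E E∈P = begin
  y E              ≡⟨ y≡mA ⟩
  mA E             ≡⟨ *-identityˡ (mA E) ⟨
  1ℚ * mA E        ≡⟨ cong (_* mA E) (sign-square (size E)) ⟨
  (s * s) * mA E   ≡⟨ *-assoc s s (mA E) ⟩
  s * (s * mA E)   ≡⟨ cong (s *_) (moment-compl F A α v E) ⟨
  s * mĀ E         ≡⟨ cong (s *_) z≡mĀ ⟨
  s * z E          ∎
  where
  open ≡-Reasoning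
  α = density F A
  s = (- 1ℚ) ^ℚ size E
  Ā-resp : ∀ x y → _≈_ F x y → compl F A x ≡ compl F A y
  Ā-resp x y x≈y = cong not (A-resp x y x≈y)
  module MA = Moment F A α v
  module MĀ = Moment F (compl F A) (1ℚ - α) v
  mA = MA.moment
  mĀ = MĀ.moment
  y≡mA : y E ≡ mA E
  y≡mA = J-injective α y mA (λ E′ E′∈P → trans (y-solves E′ E′∈P)
                                               (MA.Γ≡J-moment A-resp (density-isMean F A) E′)) E E∈P
  z≡mĀ : z E ≡ mĀ E
  z≡mĀ = J-injective (1ℚ - α) z mĀ (λ E′ E′∈P → trans (z-solves E′ E′∈P)
           (MĀ.Γ≡J-moment Ā-resp (compl-isMean F {A} {α} (density-isMean F A)) E′)) E E∈P
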